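{- Let $A\subseteq\mathbb Z_+^2$ and let $k$ be a nonnegative integer. Then $$|\pi_x(A_{>k})|+|\pi_y(A_{>k})|\le\left(1+\frac{1}{k+1}\right)|A_{>k}|.$$
   Context: $\mathbb Z_+=\{0,1,2,\dots\}$. For $A\subseteq\mathbb Z_+^2$ and $x\in\mathbb Z_+^2$, $\mathrm{row}(x,A)$ (resp. $\mathrm{col}(x,A)$) is the number of points of $A$ on the horizontal (resp. vertical) line through $x$; $A_{>k}=\{x\in A:\mathrm{row}(x,A)>k\text{ or }\mathrm{col}(x,A)>k\}$. $\pi_x$ and $\pi_y$ denote the projections onto the $x$-axis and $y$-axis. -}

module Defs where

open import Data.Nat using (ℕ; _<?_)
open import Data.Nat.Properties using (_≟_)
open import Data.Product using (_×_; proj₁; proj₂)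
open import Data.List using (List; length; filter; map; deduplicate)
open import Relation.Nullary.Decidable using (_⊎-dec_)
open import Relation.Binary.PropositionalEquality using (_≡_)

-- Points of ℤ₊² are pairs (x , y) of naturals; a finite set A ⊆ ℤ₊² is a
-- duplicate-free list of points (uniqueness imposed in the statement).
Point : Set
Point = ℕ × ℕ

row : Point → List Point → ℕ
row p A = length (filter (λ q → proj₂ q ≟ proj₂ p) A)

col : Point → List Point → ℕ
col p A = length (filter (λ q → proj₁ q ≟ proj₁ p) A)

A>_ : List Point → ℕ → List Point
A>_ A k = filter (λ p → (k <? row p A) ⊎-dec (k <? col p A)) A

|πx| : List Point → ℕ
|πx| B = length (deduplicate _≟_ (map proj₁ B))

|πy| : List Point → ℕ
|πy| B = length (deduplicate _≟_ (map proj₂ B))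

-- Give each point of B = A_{>k} two weights: along its column, 1 if the
-- column of B holds more than k points and k + 1 otherwise; along its row,
-- likewise. Every nonempty column of B then carries total column weight at
-- least k + 1, so (k + 1)|π_x(B)| is at most the total column weight, and
-- similarly for rows. A point of B lies on a line of A with more than k
-- points, and that whole line lies in B, so one of its two weights is 1 and
-- the other at most k + 1: the total weight is at most (k + 2)|B|.
module Submission where

open import Defs
open import Level using (Level)
open import Data.Nat using (ℕ; suc; _+_; _*_; _≤_; _<_; _<?_; z≤n; s≤s)
open import Data.Nat.Properties
open import Data.List using (List; []; _∷_; length; filter; map; deduplicate)
open import Data.Nat.ListAction using (sum)
open import Data.List.Properties using (filter-accept; filter-reject; filter-all; filter-some)
open import Data.List.Relation.Unary.All as All using (All)
open import Data.List.Relation.Unary.Any as Any using (here; there)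
open import Data.List.Relation.Unary.AllPairs using (_∷_)
open import Data.List.Relation.Unary.Unique.Propositional using (Unique)
open import Data.List.Relation.Unary.Unique.DecPropositional.Properties _≟_ using (deduplicate-!)
open import Data.List.Membership.DecPropositional _≟_ using (_∈?_)
open import Data.List.Membership.Propositional using (_∈_)
open import Data.List.Membership.Propositional.Properties
  using (∈-map⁺; ∈-map⁻; ∈-filter⁻; ∈-deduplicate⁺; ∈-deduplicate⁻)
open import Data.Product using (_×_; _,_; proj₁; proj₂)
open import Data.Sum using (_⊎_; inj₁; inj₂)
open import Relation.Nullary using (yes; no; contradiction; _⊎-dec_)
open import Relation.Unary using (Pred; Decidable)
open import Relation.Unary.Properties using (∁?)
open import Relation.Binary.PropositionalEquality
open import Algebra.Properties.CommutativeSemigroup +-commutativeSemigroup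
  using (interchange; x∙yz≈y∙xz)

private
  variable
    a p q r : Level
    A : Set a

filter-filter : {P : Pred A p} {Q : Pred A q} {R : Pred A r}
                (P? : Decidable P) (Q? : Decidable Q) (R? : Decidable R) →
                (∀ {x} → P x → Q x → R x) → (∀ {x} → R x → P x × Q x) →
                ∀ xs → filter P? (filter Q? xs) ≡ filter R? xs
filter-filter P? Q? R? P∧Q⇒R R⇒P∧Q [] = refl
filter-filter P? Q? R? P∧Q⇒R R⇒P∧Q (x ∷ xs) with Q? x | R? x
... | no ¬qx | no _   = filter-filter P? Q? R? P∧Q⇒R R⇒P∧Q xs
... | no ¬qx | yes rx = contradiction (proj₂ (R⇒P∧Q rx)) ¬qx
... | yes qx | yes rx
  rewrite filter-accept P? {xs = filter Q? xs} (proj₁ (R⇒P∧Q rx))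
  = cong (x ∷_) (filter-filter P? Q? R? P∧Q⇒R R⇒P∧Q xs)
... | yes qx | no ¬rx
  rewrite filter-reject P? {xs = filter Q? xs} (λ px → ¬rx (P∧Q⇒R px qx))
  = filter-filter P? Q? R? P∧Q⇒R R⇒P∧Q xs

module _ (f : A → ℕ) where

  sum-map-filter : {P : Pred A p} (P? : Decidable P) → ∀ xs →
    sum (map f xs) ≡ sum (map f (filter P? xs)) + sum (map f (filter (∁? P?) xs))
  sum-map-filter P? [] = refl
  sum-map-filter P? (x ∷ xs) with P? x
  ... | yes _ = trans (cong (f x +_) (sum-map-filter P? xs)) (sym (+-assoc (f x) _ _))
  ... | no _  = trans (cong (f x +_) (sum-map-filter P? xs))
                      (x∙yz≈y∙xz (f x) (sum (map f (filter P? xs))) _)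

  *-length-≤-sum-map : ∀ {m} xs → (∀ {x} → x ∈ xs → m ≤ f x) → length xs * m ≤ sum (map f xs)
  *-length-≤-sum-map []       _     = z≤n
  *-length-≤-sum-map (x ∷ xs) m≤f =
    +-mono-≤ (m≤f (here refl)) (*-length-≤-sum-map xs (λ x∈ → m≤f (there x∈)))

  sum-map-≤-*-length : ∀ {m} xs → (∀ {x} → x ∈ xs → f x ≤ m) → sum (map f xs) ≤ length xs * m
  sum-map-≤-*-length []       _     = z≤n
  sum-map-≤-*-length (x ∷ xs) f≤m =
    +-mono-≤ (f≤m (here refl)) (sum-map-≤-*-length xs (λ x∈ → f≤m (there x∈)))

sum-map-+ : (f g : A → ℕ) → ∀ xs →
  sum (map (λ x → f x + g x) xs) ≡ sum (map f xs) + sum (map g xs)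
sum-map-+ f g []       = refl
sum-map-+ f g (x ∷ xs) = trans (cong (f x + g x +_) (sum-map-+ f g xs)) (interchange (f x) (g x) _ _)

lineWeight : ℕ → ℕ → ℕ
lineWeight k n with k <? n
... | yes _ = 1
... | no  _ = suc k

lineWeight-≤ : ∀ k n → lineWeight k n ≤ suc k
lineWeight-≤ k n with k <? n
... | yes _ = s≤s z≤n
... | no  _ = ≤-refl

lineWeight-heavy : ∀ {k n} → k < n → lineWeight k n ≡ 1
lineWeight-heavy {k} {n} k<n with k <? n
... | yes _   = refl
... | no  k≮n = contradiction k<n k≮n

suc-≤-*-lineWeight : ∀ k {n} → 0 < n → suc k ≤ n * lineWeight k n
suc-≤-*-lineWeight k {suc n} _ with k <? suc n
... | yes k<n = subst (suc k ≤_) (sym (*-identityʳ (suc n))) k<n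
... | no  _   = m≤m+n (suc k) (n * suc k)

lineWeight-+-≤ : ∀ k {m n} → k < m ⊎ k < n → lineWeight k m + lineWeight k n ≤ suc (suc k)
lineWeight-+-≤ k {m} {n} (inj₁ k<m) rewrite lineWeight-heavy k<m = s≤s (lineWeight-≤ k n)
lineWeight-+-≤ k {m} {n} (inj₂ k<n) rewrite lineWeight-heavy k<n | +-comm (lineWeight k m) 1 =
  s≤s (lineWeight-≤ k m)

module Fibres {T : Set a} (key : T → ℕ) where

  fibre : ℕ → List T → List T
  fibre v = filter (λ x → key x ≟ v)

  keys : List T → List ℕ
  keys xs = deduplicate _≟_ (map key xs)

  fibre-filter : ∀ {v} {P : Pred T p} (P? : Decidable P) → (∀ {x} → key x ≡ v → P x) →
                 ∀ xs → fibre v (filter P? xs) ≡ fibre v xs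
  fibre-filter P? fibre⊆P = filter-filter _ P? _ (λ eq _ → eq) (λ eq → eq , fibre⊆P eq)

  module _ (w : T → ℕ) {c : ℕ} (xs : List T) where

    -- Stated for an arbitrary duplicate-free list of values, rather than keys xs,
    -- so that the induction is structural.
    length-*-≤-sum-over-keys : ∀ vs → Unique vs →
                               (∀ {v} → v ∈ vs → c ≤ sum (map w (fibre v xs))) →
                               length vs * c ≤ sum (map w (filter (λ x → key x ∈? vs) xs))
    length-*-≤-sum-over-keys []       _             _     = z≤n
    length-*-≤-sum-over-keys (v ∷ vs) (v∉vs ∷ !vs) c≤fibre = begin
      c + length vs * c
        ≤⟨ +-mono-≤ (c≤fibre (here refl)) rest ⟩
      sum (map w (fibre v xs)) + sum (map w (filter (λ x → key x ∈? vs) xs))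
        ≡⟨ cong₂ (λ ys zs → sum (map w ys) + sum (map w zs)) (sym onFibre) (sym offFibre) ⟩
      sum (map w (filter on? inVs)) + sum (map w (filter (∁? on?) inVs))
        ≡⟨ sum-map-filter w on? inVs ⟨
      sum (map w inVs) ∎
      where
      open ≤-Reasoning
      on? : Decidable (λ x → key x ≡ v)
      on? x = key x ≟ v
      inVs : List T
      inVs = filter (λ x → key x ∈? v ∷ vs) xs
      rest : length vs * c ≤ sum (map w (filter (λ x → key x ∈? vs) xs))
      rest = length-*-≤-sum-over-keys vs !vs (λ v∈ → c≤fibre (there v∈))
      onFibre : filter on? inVs ≡ fibre v xs
      onFibre = filter-filter _ _ _ (λ eq _ → eq) (λ eq → eq , here eq) xs
      offFibre : filter (∁? on?) inVs ≡ filter (λ x → key x ∈? vs) xs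
      offFibre = filter-filter _ _ _
        (λ { ≢v (here eq) → contradiction eq ≢v ; _ (there ∈vs) → ∈vs })
        (λ ∈vs → (λ eq → All.lookup v∉vs (subst (_∈ vs) eq ∈vs) refl) , there ∈vs)
        xs

    length-keys-*-≤-sum : (∀ {x} → x ∈ xs → c ≤ sum (map w (fibre (key x) xs))) →
                          length (keys xs) * c ≤ sum (map w xs)
    length-keys-*-≤-sum c≤fibre =
      subst (length (keys xs) * c ≤_) (cong (λ ys → sum (map w ys)) (filter-all _ keys-cover))
        (length-*-≤-sum-over-keys (keys xs) (deduplicate-! _) c≤fibre-keys)
      where
      keys-cover : All (λ x → key x ∈ keys xs) xs
      keys-cover = All.tabulate (λ x∈ → ∈-deduplicate⁺ _≟_ (∈-map⁺ key x∈))
      c≤fibre-keys : ∀ {v} → v ∈ keys xs → c ≤ sum (map w (fibre v xs))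
      c≤fibre-keys v∈ with ∈-map⁻ key (∈-deduplicate⁻ _≟_ (map key xs) v∈)
      ... | _ , x∈ , refl = c≤fibre x∈

  fibreWeight : ℕ → List T → T → ℕ
  fibreWeight k xs x = lineWeight k (length (fibre (key x) xs))

  suc-≤-sum-fibreWeight : ∀ k xs {x} → x ∈ xs →
                          suc k ≤ sum (map (fibreWeight k xs) (fibre (key x) xs))
  suc-≤-sum-fibreWeight k xs {x} x∈ = begin
    suc k                                        ≤⟨ suc-≤-*-lineWeight k nonempty ⟩
    length S * lineWeight k (length S)           ≤⟨ *-length-≤-sum-map (fibreWeight k xs) S constant ⟩
    sum (map (fibreWeight k xs) S)               ∎
    where
    open ≤-Reasoning
    S : List T
    S = fibre (key x) xs
    nonempty : 0 < length S
    nonempty = filter-some _ (Any.map (λ eq → cong key (sym eq)) x∈)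
    constant : ∀ {y} → y ∈ S → lineWeight k (length S) ≤ fibreWeight k xs y
    constant y∈ rewrite proj₂ (∈-filter⁻ (λ y → key y ≟ key x) {xs = xs} y∈) = ≤-refl

  length-keys-*-≤-sum-fibreWeight : ∀ k xs →
                                    length (keys xs) * suc k ≤ sum (map (fibreWeight k xs) xs)
  length-keys-*-≤-sum-fibreWeight k xs =
    length-keys-*-≤-sum (fibreWeight k xs) xs (suc-≤-sum-fibreWeight k xs)

module Columns = Fibres {T = Point} proj₁
module Rows    = Fibres {T = Point} proj₂

module _ (A : List Point) (k : ℕ) where

  private
    heavy? : Decidable (λ p → k < row p A ⊎ k < col p A)
    heavy? p = (k <? row p A) ⊎-dec (k <? col p A)

  col-A> : ∀ p → k < col p A → col p (A>_ A k) ≡ col p A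
  col-A> p k<col = cong length (Columns.fibre-filter heavy?
    (λ eq → inj₂ (subst (λ v → k < length (Columns.fibre v A)) (sym eq) k<col)) A)

  row-A> : ∀ p → k < row p A → row p (A>_ A k) ≡ row p A
  row-A> p k<row = cong length (Rows.fibre-filter heavy?
    (λ eq → inj₁ (subst (λ v → k < length (Rows.fibre v A)) (sym eq) k<row)) A)

  fibreWeights-≤ : ∀ {p} → p ∈ A>_ A k →
    Columns.fibreWeight k (A>_ A k) p + Rows.fibreWeight k (A>_ A k) p ≤ suc (suc k)
  fibreWeights-≤ {p} p∈ with proj₂ (∈-filter⁻ heavy? {xs = A} p∈)
  ... | inj₁ k<row = lineWeight-+-≤ k (inj₂ (subst (k <_) (sym (row-A> p k<row)) k<row))
  ... | inj₂ k<col = lineWeight-+-≤ k (inj₁ (subst (k <_) (sym (col-A> p k<col)) k<col))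

-- Both sides count repeated points with multiplicity.
lemma2p6 : (A : List Point) → Unique A → (k : ℕ) →
    (k + 1) * (|πx| (A>_ A k) + |πy| (A>_ A k)) ≤ (k + 2) * length (A>_ A k)
lemma2p6 A _ k = begin
  (k + 1) * (|πx| B + |πy| B)              ≡⟨ *-comm (k + 1) _ ⟩
  (|πx| B + |πy| B) * (k + 1)              ≡⟨ *-distribʳ-+ (k + 1) (|πx| B) (|πy| B) ⟩
  |πx| B * (k + 1) + |πy| B * (k + 1)      ≡⟨ cong (λ m → |πx| B * m + |πy| B * m) (+-comm k 1) ⟩
  |πx| B * suc k + |πy| B * suc k          ≤⟨ +-mono-≤ (Columns.length-keys-*-≤-sum-fibreWeight k B)
                                                        (Rows.length-keys-*-≤-sum-fibreWeight k B) ⟩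
  sum (map columnWeight B) + sum (map rowWeight B)
                                           ≡⟨ sum-map-+ columnWeight rowWeight B ⟨
  sum (map (λ p → columnWeight p + rowWeight p) B)
                                           ≤⟨ sum-map-≤-*-length _ B (fibreWeights-≤ A k) ⟩
  length B * suc (suc k)                   ≡⟨ *-comm (length B) _ ⟩
  suc (suc k) * length B                   ≡⟨ cong (_* length B) (+-comm 2 k) ⟩
  (k + 2) * length B                       ∎
  where
  open ≤-Reasoning
  B : List Point
  B = A>_ A k
  columnWeight rowWeight : Point → ℕ
  columnWeight = Columns.fibreWeight k B
  rowWeight    = Rows.fibreWeight k B
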